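{- Let $K$ be a real quadratic field with notation as below, and let $j,m$ be positive integers. Then $r_{j,m}$ is invertible modulo $\bar d_{j,m}$, and its multiplicative inverse $r_{j,m}^{ -1}$ modulo $\bar d_{j,m}$ satisfies $$r_{j,m}^{ -1}\equiv r_{j,m}\,(1+d_j+d_{j,m})\pmod{\bar d_{j,m}}.$$
   Context: Let $K\subset\mathbb{R}$ be a real quadratic field of discriminant $\Delta_0$, and let $\varepsilon$ be the smallest unit of $K$ of norm $+1$ that is greater than $1$. For positive integers $j$ set $f_j=(\varepsilon^j-\varepsilon^{ -j})/\sqrt{\Delta_0}$. For positive integers $j,m$ set $r_{j,m}=f_{jm}/f_j$, $d_{j,m}=r_{j,m+1}+r_{j,m}$, $d_j=d_{j,1}$. For a positive integer $d$, $\bar d=d$ if $d$ is odd and $\bar d=2d$ if $d$ is even. -}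

module Defs where

open import Data.Nat using (ℕ; zero; suc; _+_; _*_; _≤_; _<_)
open import Data.Nat.DivMod using (_/_; _%_)
open import Data.Nat.Divisibility using (_∣_)
open import Data.Nat.Primality using (Prime)
open import Data.Product using (_×_; Σ)
open import Data.Sum using (_⊎_)
open import Relation.Nullary using (¬_)
open import Relation.Binary.PropositionalEquality using (_≡_)
open import Data.Integer as ℤ using (ℤ; +_)
import Data.Integer.Divisibility as ℤD

Squarefree : ℕ → Set
Squarefree n = ∀ p → Prime p → ¬ (p * p ∣ n)

RealQuadDisc : ℕ → Set
RealQuadDisc Δ = (1 < Δ) ×
  ((Δ % 4 ≡ 1 × Squarefree Δ) ⊎
   Σ ℕ (λ m → Δ ≡ 4 * m × (m % 4 ≡ 2 ⊎ m % 4 ≡ 3) × Squarefree m))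

-- (t + u√Δ)/2 is a unit of O_K of norm +1 greater than 1:
-- t, u ≥ 1 and t² − Δu² = 4.
NormOneUnitGt1 : ℕ → ℕ → ℕ → Set
NormOneUnitGt1 Δ t u = (1 ≤ t) × (1 ≤ u) × (t * t ≡ Δ * (u * u) + 4)

-- ε = (t + u√Δ)/2 is the smallest unit > 1 of norm +1
-- (on such units, the real order coincides with the order of u).
FundNormOneUnit : ℕ → ℕ → ℕ → Set
FundNormOneUnit Δ t u = NormOneUnitGt1 Δ t u ×
  (∀ t' u' → NormOneUnitGt1 Δ t' u' → u ≤ u')

-- exact natural quotient (divisor 0 gives 0; never used with divisor 0)
quot : ℕ → ℕ → ℕ
quot a zero = 0
quot a (suc k) = a / suc k

-- ε^j = (A j + B j √Δ)/2, computed by ε^{j+1} = ε^j · ε: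
-- ((a + b√Δ)/2)((t + u√Δ)/2) = ((at + buΔ)/2 + ((au + bt)/2)√Δ)/2
-- (the divisions by 2 are exact).
powPair : (Δ t u : ℕ) → ℕ → ℕ × ℕ
powPair Δ t u zero = 2 Data.Product., 0
powPair Δ t u (suc j) with powPair Δ t u j
... | a Data.Product., b =
  ((a * t + b * u * Δ) / 2) Data.Product., ((a * u + b * t) / 2)

-- f_j = (ε^j − ε^{−j})/√Δ.  Since N(ε) = 1, ε^{−j} = (A j − B j √Δ)/2, so f_j = B j.
f : (Δ t u : ℕ) → ℕ → ℕ
f Δ t u j = Data.Product.proj₂ (powPair Δ t u j)

r : (Δ t u : ℕ) → ℕ → ℕ → ℕ
r Δ t u j m = quot (f Δ t u (j * m)) (f Δ t u j)

d : (Δ t u : ℕ) → ℕ → ℕ → ℕ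
d Δ t u j m = r Δ t u j (suc m) + r Δ t u j m

dj : (Δ t u : ℕ) → ℕ → ℕ
dj Δ t u j = d Δ t u j 1

bar : ℕ → ℕ
bar n with n % 2
... | zero = 2 * n
... | suc _ = n

_≡_[mod_] : ℤ → ℤ → ℕ → Set
x ≡ y [mod n ] = (+ n) ℤD.∣ (x ℤ.- y)

-- Write ε = (t + u√Δ)/2 and let U, V be the Lucas sequences of (t, 1), so that
-- ε^n = (V n + u U n √Δ)/2 and f n = u U n.  Since U (j m) = U j · W m, where W is the
-- Lucas sequence of (a, 1) with a = V j, we get r_{j,m} = W m, d_j = a + 1 and
-- d_{j,m} = R + r with R = W (m+1), r = W m.  Cassini's identity R² − a R r + r² = 1
-- becomes (a + 2) r² ≡ 1 modulo D = R + r because R ≡ −r; exactly,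
-- r (1 + d_j + D) r − 1 = D (r² + (a + 2) r − D).  When D is even, Cassini forces
-- a r² to be odd, so the second factor is even and the congruence holds modulo 2D.
-- Finally, an inverse modulo n is unique modulo n.
module Submission where

open import Data.Nat using (ℕ; zero; suc; s≤s; _≤_)
import Data.Nat as ℕ
import Data.Nat.Properties as ℕ
import Data.Nat.Tactic.RingSolver as ℕ-Solver
open import Data.Nat.DivMod using (_/_; m*n/n≡m)
open import Data.Nat.Divisibility using (divides)
import Data.Nat.Divisibility as ℕ
open import Data.Integer using (ℤ; +_; -[1+_]; _+_; _*_; _-_; -_)
import Data.Integer.Properties as ℤ
import Data.Integer.DivMod as ℤ
import Data.Integer.Divisibility.Signed as ℤ
open import Data.Integer.Tactic.RingSolver using (solve-∀)
open import Data.Product using (Σ; ∃; ∃₂; _×_; _,_; proj₁; proj₂)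
open import Data.Sum using (_⊎_; inj₁; inj₂)
open import Relation.Binary.PropositionalEquality

open import Defs

≡-by-difference : ∀ {x y a b : ℤ} c → x - y ≡ c * (a - b) → a ≡ b → x ≡ y
≡-by-difference {x} {y} {a} c x-y≡c[a-b] refl =
  ℤ.i-j≡0⇒i≡j x y (trans x-y≡c[a-b] (trans (cong (c *_) (ℤ.+-inverseʳ a)) (ℤ.*-zeroʳ c)))

U : ℤ → ℕ → ℤ
U P 0 = + 0
U P 1 = + 1
U P (suc (suc n)) = P * U P (suc n) - U P n

V : ℤ → ℕ → ℤ
V P n = + 2 * U P (suc n) - P * U P n

quadForm : ℤ → ℤ → ℤ → ℤ
quadForm P x y = x * x - P * x * y + y * y

U-suc-+ : ∀ P m n → U P (suc (m ℕ.+ n)) ≡ U P (suc m) * U P (suc n) - U P m * U P n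
U-suc-+ P 0 n = base (U P (suc n)) (U P n)
  where
  base : ∀ b₁ b₀ → b₁ ≡ + 1 * b₁ - + 0 * b₀
  base = solve-∀
U-suc-+ P 1 n = base P (U P (suc n)) (U P n)
  where
  base : ∀ P b₁ b₀ → P * b₁ - b₀ ≡ (P * + 1 - + 0) * b₁ - + 1 * b₀
  base = solve-∀
U-suc-+ P (suc (suc m)) n = begin
  P * U P (suc (suc m ℕ.+ n)) - U P (suc (m ℕ.+ n))
    ≡⟨ cong₂ (λ x y → P * x - y) (U-suc-+ P (suc m) n) (U-suc-+ P m n) ⟩
  P * (U P (suc (suc m)) * b₁ - a₁ * b₀) - (a₁ * b₁ - a₀ * b₀)
    ≡⟨ step P a₁ a₀ b₁ b₀ ⟩
  (P * U P (suc (suc m)) - a₁) * b₁ - U P (suc (suc m)) * b₀ ∎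
  where
  open ≡-Reasoning
  a₁ = U P (suc m); a₀ = U P m; b₁ = U P (suc n); b₀ = U P n
  step : ∀ P a₁ a₀ b₁ b₀ → P * ((P * a₁ - a₀) * b₁ - a₁ * b₀) - (a₁ * b₁ - a₀ * b₀)
                         ≡ (P * (P * a₁ - a₀) - a₁) * b₁ - (P * a₁ - a₀) * b₀
  step = solve-∀

U-cassini : ∀ P n → quadForm P (U P (suc n)) (U P n) ≡ + 1
U-cassini P 0 = base P
  where
  base : ∀ P → + 1 * + 1 - P * + 1 * + 0 + + 0 * + 0 ≡ + 1
  base = solve-∀
U-cassini P (suc n) = trans (step P (U P (suc n)) (U P n)) (U-cassini P n)
  where
  step : ∀ P a b → (P * a - b) * (P * a - b) - P * (P * a - b) * a + a * a ≡ a * a - P * a * b + b * b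
  step = solve-∀

U-+-+ : ∀ P k q → U P (q ℕ.+ k ℕ.+ k) ≡ V P k * U P (q ℕ.+ k) - U P q
U-+-+ P 0 0 = base P
  where
  base : ∀ P → + 0 ≡ (+ 2 * + 1 - P * + 0) * + 0 - + 0
  base = solve-∀
U-+-+ P (suc k) 0 = trans (U-suc-+ P k (suc k)) (base P (U P (suc k)) (U P k))
  where
  base : ∀ P a₁ a₀ → a₁ * (P * a₁ - a₀) - a₀ * a₁ ≡ (+ 2 * (P * a₁ - a₀) - P * a₁) * a₁ - + 0
  base = solve-∀
U-+-+ P k 1 = trans (U-suc-+ P k k) (≡-by-difference (- + 1) (base P (U P (suc k)) (U P k)) (U-cassini P k))
  where
  base : ∀ P a₁ a₀ → (a₁ * a₁ - a₀ * a₀) - ((+ 2 * a₁ - P * a₀) * a₁ - + 1)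
                   ≡ - + 1 * ((a₁ * a₁ - P * a₁ * a₀ + a₀ * a₀) - + 1)
  base = solve-∀
U-+-+ P k (suc (suc q)) = begin
  P * U P (suc q ℕ.+ k ℕ.+ k) - U P (q ℕ.+ k ℕ.+ k)
    ≡⟨ cong₂ (λ x y → P * x - y) (U-+-+ P k (suc q)) (U-+-+ P k q) ⟩
  P * (V P k * U P (suc (q ℕ.+ k)) - U P (suc q)) - (V P k * U P (q ℕ.+ k) - U P q)
    ≡⟨ step P (V P k) (U P (suc (q ℕ.+ k))) (U P (q ℕ.+ k)) (U P (suc q)) (U P q) ⟩
  V P k * (P * U P (suc (q ℕ.+ k)) - U P (q ℕ.+ k)) - (P * U P (suc q) - U P q) ∎
  where
  open ≡-Reasoning
  step : ∀ P W c₁ c₀ d₁ d₀ → P * (W * c₁ - d₁) - (W * c₀ - d₀)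
                           ≡ W * (P * c₁ - c₀) - (P * d₁ - d₀)
  step = solve-∀

U-* : ∀ P k m → U P (k ℕ.* m) ≡ U P k * U (V P k) m
U-* P k 0 = trans (cong (U P) (ℕ.*-zeroʳ k)) (sym (ℤ.*-zeroʳ (U P k)))
U-* P k 1 = trans (cong (U P) (ℕ.*-identityʳ k)) (sym (ℤ.*-identityʳ (U P k)))
U-* P k (suc (suc m)) = begin
  U P (k ℕ.* suc (suc m))
    ≡⟨ cong (U P) (index k m) ⟩
  U P (k ℕ.* m ℕ.+ k ℕ.+ k)
    ≡⟨ U-+-+ P k (k ℕ.* m) ⟩
  W * U P (k ℕ.* m ℕ.+ k) - U P (k ℕ.* m)
    ≡⟨ cong₂ (λ x y → W * x - y) (trans (cong (U P) (index′ k m)) (U-* P k (suc m))) (U-* P k m) ⟩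
  W * (U P k * U W (suc m)) - U P k * U W m
    ≡⟨ step W (U P k) (U W (suc m)) (U W m) ⟩
  U P k * (W * U W (suc m) - U W m) ∎
  where
  open ≡-Reasoning
  W = V P k
  index : ∀ k m → k ℕ.* suc (suc m) ≡ k ℕ.* m ℕ.+ k ℕ.+ k
  index = ℕ-Solver.solve-∀
  index′ : ∀ k m → k ℕ.* m ℕ.+ k ≡ k ℕ.* suc m
  index′ = ℕ-Solver.solve-∀
  step : ∀ W a b₁ b₀ → W * (a * b₁) - a * b₀ ≡ a * (W * b₁ - b₀)
  step = solve-∀

+[m+n]-+m≡+n : ∀ m n → + (m ℕ.+ n) - + m ≡ + n
+[m+n]-+m≡+n m n = trans (cong (_- + m) (ℤ.pos-+ m n)) (cancel (+ m) (+ n))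
  where
  cancel : ∀ a b → a + b - a ≡ b
  cancel = solve-∀

U-increasing : ∀ p n →
  ∃₂ λ x y → U (+ (2 ℕ.+ p)) n ≡ + x × U (+ (2 ℕ.+ p)) (suc n) ≡ + (x ℕ.+ suc y)
U-increasing p 0 = 0 , 0 , refl , refl
U-increasing p (suc n) with U-increasing p n
... | x , y , Uₙ≡x , Uₙ₊₁≡x′ = x′ , y ℕ.+ p ℕ.* x′ , Uₙ₊₁≡x′ , (begin
  + (2 ℕ.+ p) * U (+ (2 ℕ.+ p)) (suc n) - U (+ (2 ℕ.+ p)) n
    ≡⟨ cong₂ (λ a b → + (2 ℕ.+ p) * a - b) Uₙ₊₁≡x′ Uₙ≡x ⟩
  + (2 ℕ.+ p) * + x′ - + x
    ≡⟨ cong (_- + x) (sym (ℤ.pos-* (2 ℕ.+ p) x′)) ⟩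
  + ((2 ℕ.+ p) ℕ.* x′) - + x
    ≡⟨ cong (λ z → + z - + x) (expand p x y) ⟩
  + (x ℕ.+ (x′ ℕ.+ suc (y ℕ.+ p ℕ.* x′))) - + x
    ≡⟨ +[m+n]-+m≡+n x _ ⟩
  + (x′ ℕ.+ suc (y ℕ.+ p ℕ.* x′)) ∎)
  where
  open ≡-Reasoning
  x′ = x ℕ.+ suc y
  expand : ∀ p x y → (2 ℕ.+ p) ℕ.* (x ℕ.+ suc y)
                   ≡ x ℕ.+ (x ℕ.+ suc y ℕ.+ suc (y ℕ.+ p ℕ.* (x ℕ.+ suc y)))
  expand = ℕ-Solver.solve-∀

quot-exact : ∀ n d c w → d ≡ suc c → + n ≡ + suc c * w → + quot n d ≡ w
quot-exact n _ c (+ w) refl n≡[1+c]w = cong +_ (begin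
  n / suc c         ≡⟨ cong (_/ suc c) (ℤ.+-injective (trans n≡[1+c]w (sym (ℤ.pos-* (suc c) w)))) ⟩
  suc c ℕ.* w / suc c ≡⟨ cong (_/ suc c) (ℕ.*-comm (suc c) w) ⟩
  w ℕ.* suc c / suc c ≡⟨ m*n/n≡m w (suc c) ⟩
  w                 ∎)
  where open ≡-Reasoning
quot-exact n _ c -[1+ w ] refl ()

module _ (Δ t u : ℕ) (norm-one : t ℕ.* t ≡ Δ ℕ.* (u ℕ.* u) ℕ.+ 4) where

  norm-oneℤ : + t * + t ≡ + Δ * (+ u * + u) + + 4
  norm-oneℤ = begin
    + t * + t                 ≡⟨ sym (ℤ.pos-* t t) ⟩
    + (t ℕ.* t)               ≡⟨ cong +_ norm-one ⟩
    + (Δ ℕ.* (u ℕ.* u) ℕ.+ 4) ≡⟨ ℤ.pos-+ (Δ ℕ.* (u ℕ.* u)) 4 ⟩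
    + (Δ ℕ.* (u ℕ.* u)) + + 4 ≡⟨ cong (_+ + 4) (trans (ℤ.pos-* Δ _) (cong (+ Δ *_) (ℤ.pos-* u u))) ⟩
    + Δ * (+ u * + u) + + 4   ∎
    where open ≡-Reasoning

  powPair≡V,uU : ∀ n →
    + proj₁ (powPair Δ t u n) ≡ V (+ t) n × + proj₂ (powPair Δ t u n) ≡ + u * U (+ t) n
  powPair≡V,uU 0 = base (+ t) , sym (ℤ.*-zeroʳ (+ u))
    where
    base : ∀ T → + 2 ≡ + 2 * + 1 - T * + 0
    base = solve-∀
  powPair≡V,uU (suc n) with powPair Δ t u n | powPair≡V,uU n
  ... | a , b | a≡V , b≡uU = quot-exact _ 2 1 _ refl a*t+b*u*Δ≡2V , quot-exact _ 2 1 _ refl a*u+b*t≡2uU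
    where
    Uₙ₊₁ = U (+ t) (suc n)
    Uₙ = U (+ t) n
    a*t+b*u*Δ≡2V : + (a ℕ.* t ℕ.+ b ℕ.* u ℕ.* Δ) ≡ + 2 * V (+ t) (suc n)
    a*t+b*u*Δ≡2V = begin
      + (a ℕ.* t ℕ.+ b ℕ.* u ℕ.* Δ)
        ≡⟨ trans (ℤ.pos-+ (a ℕ.* t) _)
             (cong₂ _+_ (ℤ.pos-* a t) (trans (ℤ.pos-* (b ℕ.* u) Δ) (cong (_* + Δ) (ℤ.pos-* b u)))) ⟩
      + a * + t + + b * + u * + Δ
        ≡⟨ cong₂ (λ x y → x * + t + y * + u * + Δ) a≡V b≡uU ⟩
      V (+ t) n * + t + + u * Uₙ * + u * + Δ
        ≡⟨ ≡-by-difference (- Uₙ) (norm (+ t) (+ u) (+ Δ) Uₙ₊₁ Uₙ) norm-oneℤ ⟩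
      + 2 * V (+ t) (suc n) ∎
      where
      open ≡-Reasoning
      norm : ∀ T W D a₁ a₀ →
        ((+ 2 * a₁ - T * a₀) * T + W * a₀ * W * D) - + 2 * (+ 2 * (T * a₁ - a₀) - T * a₁)
          ≡ - a₀ * (T * T - (D * (W * W) + + 4))
      norm = solve-∀
    a*u+b*t≡2uU : + (a ℕ.* u ℕ.+ b ℕ.* t) ≡ + 2 * (+ u * Uₙ₊₁)
    a*u+b*t≡2uU = begin
      + (a ℕ.* u ℕ.+ b ℕ.* t)
        ≡⟨ trans (ℤ.pos-+ (a ℕ.* u) _) (cong₂ _+_ (ℤ.pos-* a u) (ℤ.pos-* b t)) ⟩
      + a * + u + + b * + t
        ≡⟨ cong₂ (λ x y → x * + u + y * + t) a≡V b≡uU ⟩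
      V (+ t) n * + u + + u * Uₙ * + t
        ≡⟨ norm (+ t) (+ u) Uₙ₊₁ Uₙ ⟩
      + 2 * (+ u * Uₙ₊₁) ∎
      where
      open ≡-Reasoning
      norm : ∀ T W a₁ a₀ → (+ 2 * a₁ - T * a₀) * W + W * a₀ * T ≡ + 2 * (W * a₁)
      norm = solve-∀

even⊎odd : ∀ r → ∃ λ p → r ≡ p * + 2 ⊎ r ≡ + 1 + p * + 2
even⊎odd r with r ℤ.% + 2 | ℤ.n%d<d r (+ 2) | ℤ.a≡a%n+[a/n]*n r (+ 2)
... | 0 | _ | r≡0+[r/2]*2 = r ℤ./ + 2 , inj₁ (trans r≡0+[r/2]*2 (ℤ.+-identityˡ _))
... | 1 | _ | r≡1+[r/2]*2 = r ℤ./ + 2 , inj₂ r≡1+[r/2]*2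
... | suc (suc _) | s≤s (s≤s ()) | _

bar-odd⊎even : ∀ n → bar n ≡ n ⊎ (2 ℕ.∣ n × bar n ≡ 2 ℕ.* n)
bar-odd⊎even n with n ℕ.% 2 in n%2≡
... | zero = inj₂ (ℕ.m%n≡0⇒n∣m n 2 n%2≡ , refl)
... | suc _ = inj₁ refl

inverse-unique : ∀ n (x c s : ℤ) →
  (x * c) ≡ + 1 [mod n ] → (s * c) ≡ + 1 [mod n ] → s ≡ x [mod n ]
inverse-unique n x c s xc≡1 sc≡1 = ℤ.∣⇒∣ᵤ (subst (+ n ℤ.∣_) (norm x c s)
  (ℤ.∣m∣n⇒∣m-n (ℤ.∣n⇒∣m*n x (ℤ.∣ᵤ⇒∣ sc≡1)) (ℤ.∣n⇒∣m*n s (ℤ.∣ᵤ⇒∣ xc≡1))))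
  where
  norm : ∀ x c s → x * (s * c - + 1) - s * (x * c - + 1) ≡ s - x
  norm = solve-∀

inverse-numerator≡D*cofactor : ∀ a r D → quadForm a (D - r) r ≡ + 1 →
  (r * (+ 1 + (a + + 1) + D)) * r - + 1 ≡ D * (r * r + (a + + 2) * r - D)
inverse-numerator≡D*cofactor a r D cassini = ≡-by-difference (+ 1) (norm a r D) cassini
  where
  norm : ∀ a r D → ((r * (+ 1 + (a + + 1) + D)) * r - + 1) - D * (r * r + (a + + 2) * r - D)
                 ≡ + 1 * (((D - r) * (D - r) - a * (D - r) * r + r * r) - + 1)
  norm = solve-∀

-- For r odd, Cassini forces a to be odd as well, so r² + a r is even; the witness Z
-- is then half of r² + (a + 2) r − D − (quadForm a (D − r) r − 1).
cofactor-even : ∀ a r D e → D ≡ e * + 2 → quadForm a (D - r) r ≡ + 1 →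
  ∃ λ Z → r * r + (a + + 2) * r - D ≡ Z * + 2
cofactor-even a r _ e refl cassini with even⊎odd r
... | p , inj₁ refl = p * p * + 2 + (a + + 2) * p - e , norm a p e
  where
  norm : ∀ a p e → p * + 2 * (p * + 2) + (a + + 2) * (p * + 2) - e * + 2
                 ≡ (p * p * + 2 + (a + + 2) * p - e) * + 2
  norm = solve-∀
... | p , inj₂ refl = Z , ≡-by-difference (+ 1) (norm a p e) cassini
  where
  Z = + 1 - + 2 * p * p - a * p * (+ 1 + p * + 2) - e - + 2 * e * e + (+ 2 * e + a * e) * (+ 1 + p * + 2)
  norm : ∀ a p e →
    ((+ 1 + p * + 2) * (+ 1 + p * + 2) + (a + + 2) * (+ 1 + p * + 2) - e * + 2)
      - (+ 1 - + 2 * p * p - a * p * (+ 1 + p * + 2) - e - + 2 * e * e + (+ 2 * e + a * e) * (+ 1 + p * + 2)) * + 2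
    ≡ + 1 * (((e * + 2 - (+ 1 + p * + 2)) * (e * + 2 - (+ 1 + p * + 2))
              - a * (e * + 2 - (+ 1 + p * + 2)) * (+ 1 + p * + 2) + (+ 1 + p * + 2) * (+ 1 + p * + 2)) - + 1)
  norm = solve-∀

inverse-mod-bar : ∀ a R r D → + D ≡ R + r → quadForm a R r ≡ + 1 →
  ((r * (+ 1 + (a + + 1) + + D)) * r) ≡ + 1 [mod bar D ]
inverse-mod-bar a R r D D≡R+r cassini = ℤ.∣⇒∣ᵤ (bar-divides (bar-odd⊎even D))
  where
  X Q : ℤ
  X = (r * (+ 1 + (a + + 1) + + D)) * r - + 1
  Q = r * r + (a + + 2) * r - + D

  cassini′ : quadForm a (+ D - r) r ≡ + 1
  cassini′ = subst (λ R → quadForm a R r ≡ + 1) (trans (cancel R r) (cong (_- r) (sym D≡R+r))) cassini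
    where
    cancel : ∀ R r → R ≡ R + r - r
    cancel = solve-∀

  X≡DQ : X ≡ + D * Q
  X≡DQ = inverse-numerator≡D*cofactor a r (+ D) cassini′

  bar-divides : bar D ≡ D ⊎ (2 ℕ.∣ D × bar D ≡ 2 ℕ.* D) → + bar D ℤ.∣ X
  bar-divides (inj₁ bar≡D) =
    subst (λ n → + n ℤ.∣ X) (sym bar≡D) (ℤ.divides Q (trans X≡DQ (ℤ.*-comm (+ D) Q)))
  bar-divides (inj₂ (divides e D≡e*2 , bar≡2D))
    with cofactor-even a r (+ D) (+ e) (trans (cong +_ D≡e*2) (ℤ.pos-* e 2)) cassini′
  ... | Z , Q≡Z*2 = subst (λ n → + n ℤ.∣ X) (sym bar≡2D) (ℤ.divides Z (begin
    X               ≡⟨ X≡DQ ⟩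
    + D * Q         ≡⟨ cong (+ D *_) Q≡Z*2 ⟩
    + D * (Z * + 2) ≡⟨ norm (+ D) Z ⟩
    Z * (+ 2 * + D) ≡⟨ cong (Z *_) (sym (ℤ.pos-* 2 D)) ⟩
    Z * + (2 ℕ.* D) ∎))
    where
    open ≡-Reasoning
    norm : ∀ D Z → D * (Z * + 2) ≡ Z * (+ 2 * D)
    norm = solve-∀

module _ (Δ p u′ k : ℕ) (norm-one : (2 ℕ.+ p) ℕ.* (2 ℕ.+ p) ≡ Δ ℕ.* (suc u′ ℕ.* suc u′) ℕ.+ 4) where
  private
    t u j : ℕ
    t = 2 ℕ.+ p
    u = suc u′
    j = suc k
    a : ℤ
    a = V (+ t) j
    W : ℕ → ℤ
    W = U a
    rⱼ dⱼ : ℕ → ℕ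
    rⱼ = r Δ t u j
    dⱼ = d Δ t u j

  f≡uU : ∀ n → + f Δ t u n ≡ + u * U (+ t) n
  f≡uU n = proj₂ (powPair≡V,uU Δ t u norm-one n)

  r≡W : ∀ m → + rⱼ m ≡ W m
  r≡W m with U-increasing p k
  ... | x , y , _ , Uⱼ≡x+1+y = quot-exact _ _ _ (W m) fⱼ≡u[1+c] (begin
    + f Δ t u (j ℕ.* m)       ≡⟨ f≡uU (j ℕ.* m) ⟩
    + u * U (+ t) (j ℕ.* m)   ≡⟨ cong (+ u *_) (U-* (+ t) j m) ⟩
    + u * (U (+ t) j * W m)   ≡⟨ cong (λ z → + u * (z * W m)) Uⱼ≡1+c ⟩
    + u * (+ suc c * W m)     ≡⟨ sym (ℤ.*-assoc (+ u) (+ suc c) (W m)) ⟩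
    + u * + suc c * W m       ≡⟨ cong (_* W m) (sym (ℤ.pos-* u (suc c))) ⟩
    + (u ℕ.* suc c) * W m     ∎)
    where
    open ≡-Reasoning
    c = x ℕ.+ y
    Uⱼ≡1+c : U (+ t) j ≡ + suc c
    Uⱼ≡1+c = trans Uⱼ≡x+1+y (cong +_ (ℕ.+-suc x y))
    fⱼ≡u[1+c] : f Δ t u j ≡ u ℕ.* suc c
    fⱼ≡u[1+c] = ℤ.+-injective (trans (f≡uU j) (trans (cong (+ u *_) Uⱼ≡1+c) (sym (ℤ.pos-* u (suc c)))))

  dj≡a+1 : + dj Δ t u j ≡ a + + 1
  dj≡a+1 = begin
    + (rⱼ 2 ℕ.+ rⱼ 1)       ≡⟨ ℤ.pos-+ (rⱼ 2) _ ⟩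
    + rⱼ 2 + + rⱼ 1         ≡⟨ cong₂ _+_ (r≡W 2) (r≡W 1) ⟩
    (a * + 1 - + 0) + + 1  ≡⟨ norm a ⟩
    a + + 1                ∎
    where
    open ≡-Reasoning
    norm : ∀ a → (a * + 1 - + 0) + + 1 ≡ a + + 1
    norm = solve-∀

  r-inverse : ∀ m →
    Σ ℤ (λ s → (s * + rⱼ m) ≡ + 1 [mod bar (dⱼ m) ])
    × (∀ (s : ℤ) → (s * + rⱼ m) ≡ + 1 [mod bar (dⱼ m) ] →
        s ≡ (+ rⱼ m) * (+ 1 + + dj Δ t u j + + dⱼ m) [mod bar (dⱼ m) ])
  r-inverse m = (x , x-inverse) , λ s s-inverse → inverse-unique _ x _ s x-inverse s-inverse
    where
    x : ℤ
    x = + rⱼ m * (+ 1 + + dj Δ t u j + + dⱼ m)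
    cassini : quadForm a (+ rⱼ (suc m)) (+ rⱼ m) ≡ + 1
    cassini = trans (cong₂ (quadForm a) (r≡W (suc m)) (r≡W m)) (U-cassini a m)
    x-inverse : (x * + rⱼ m) ≡ + 1 [mod bar (dⱼ m) ]
    x-inverse = subst (λ b → ((+ rⱼ m * (+ 1 + b + + dⱼ m)) * + rⱼ m) ≡ + 1 [mod bar (dⱼ m) ])
      (sym dj≡a+1)
      (inverse-mod-bar a (+ rⱼ (suc m)) (+ rⱼ m) (dⱼ m) (ℤ.pos-+ (rⱼ (suc m)) _) cassini)

lemma4p24 : (Δ t u : ℕ) → RealQuadDisc Δ → FundNormOneUnit Δ t u →
    (j m : ℕ) → 1 ≤ j → 1 ≤ m →
    Σ ℤ (λ s → (s * + r Δ t u j m) ≡ + 1 [mod bar (d Δ t u j m) ])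
    × (∀ (s : ℤ) → (s * + r Δ t u j m) ≡ + 1 [mod bar (d Δ t u j m) ] →
        s ≡ (+ r Δ t u j m) * (+ 1 + + dj Δ t u j + + d Δ t u j m) [mod bar (d Δ t u j m) ])
lemma4p24 Δ 0 u _ ((() , _) , _) j m _ _
lemma4p24 Δ 1 u _ ((_ , _ , 1≡Δu²+4) , _) j m _ _ with trans 1≡Δu²+4 (ℕ.+-comm (Δ ℕ.* (u ℕ.* u)) 4)
... | ()
lemma4p24 Δ (suc (suc p)) 0 _ ((_ , () , _) , _) j m _ _
lemma4p24 Δ (suc (suc p)) (suc u′) _ _ 0 m () _
lemma4p24 Δ (suc (suc p)) (suc u′) _ ((_ , _ , norm-one) , _) (suc k) m _ _ = r-inverse Δ p u′ k norm-one m
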